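{- Let $G$ be a cocomparability graph and $P$ a partial order whose comparability graph is $\overline{G}$, with ground set $U=\{u_1,\dots,u_n\}$, and let $V=\{v_1,\dots,v_n\}$. Let $\widetilde{G}=(U,V,\widetilde{E})=\widehat{C}(P)$, let $H$ be the associated split graph of $\widetilde{G}$ and $H^*$ the conflict graph of $H$, and let $E_0=\{u_iv_i:1\le i\le n\}$. Then every $e\in E_0$ is an isolated vertex of $H^*$.
   Context: $\widehat{C}(P)=(U,V,\widetilde E)$ has $u_iv_j\in\widetilde E$ iff $u_i<_Pu_j$ does not hold (so $E_0\subseteq\widetilde E$). The associated split graph $H$ has vertex set $U\cup V$ and edge set $\widetilde{E}\cup\{vv':v,v'\in V,v\ne v'\}$. Two edges $e_1,e_2$ of $H$ are in conflict if one can write $e_1=ab$, $e_2=cd$ with $a,b,c,d$ distinct and $ad$, $bc$ non-edges of $H$; the conflict graph $H^*$ has the edges of $H$ as vertices, two being adjacent iff in conflict. -}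

module Defs where

open import Data.Nat using (ℕ)
open import Data.Fin using (Fin)
open import Data.Sum using (_⊎_; inj₁; inj₂)
open import Data.Product using (_×_)
open import Data.Empty using (⊥)
open import Relation.Nullary using (¬_)
open import Relation.Binary.PropositionalEquality using (_≡_; _≢_)
open import Relation.Binary.Structures using (IsStrictPartialOrder)

record IsGraph {n : ℕ} (G : Fin n → Fin n → Set) : Set where
  field
    sym   : ∀ {i j} → G i j → G j i
    irrefl : ∀ {i} → ¬ G i i

ComparabilityIsComplement : {n : ℕ} → (Fin n → Fin n → Set) → (Fin n → Fin n → Set) → Set
ComparabilityIsComplement {n} _<P_ G =
  ∀ (i j : Fin n) → i ≢ j →
    ((¬ G i j → (i <P j) ⊎ (j <P i)) × ((i <P j) ⊎ (j <P i) → ¬ G i j))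

-- Vertices of the split graph H: U = inj₁ i (u_i), V = inj₂ j (v_j).
Vtx : ℕ → Set
Vtx n = Fin n ⊎ Fin n

HAdj : {n : ℕ} → (Fin n → Fin n → Set) → Vtx n → Vtx n → Set
HAdj _<P_ (inj₁ i) (inj₁ i') = ⊥
HAdj _<P_ (inj₁ i) (inj₂ j)  = ¬ (i <P j)
HAdj _<P_ (inj₂ j) (inj₁ i)  = ¬ (i <P j)
HAdj _<P_ (inj₂ j) (inj₂ j') = j ≢ j'

Distinct4 : {A : Set} → A → A → A → A → Set
Distinct4 a b c d = a ≢ b × a ≢ c × a ≢ d × b ≢ c × b ≢ d × c ≢ d

ConflictOriented : {n : ℕ} → (Fin n → Fin n → Set) → Vtx n → Vtx n → Vtx n → Vtx n → Set
ConflictOriented _<P_ a b c d =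
  Distinct4 a b c d × ¬ HAdj _<P_ a d × ¬ HAdj _<P_ b c

InConflict : {n : ℕ} → (Fin n → Fin n → Set) → Vtx n → Vtx n → Vtx n → Vtx n → Set
InConflict R x y z w =
  ConflictOriented R x y z w ⊎ ConflictOriented R y x z w ⊎
  ConflictOriented R x y w z ⊎ ConflictOriented R y x w z

IsolatedInConflictGraph : {n : ℕ} → (Fin n → Fin n → Set) → Vtx n → Vtx n → Set
IsolatedInConflictGraph {n} R x y =
  HAdj R x y × (∀ (z w : Vtx n) → HAdj R z w → ¬ InConflict R x y z w)

module Submission where

-- Let c d be an edge of H in conflict with u_i v_i. Up to orientation, c ≠ v_i is a
-- non-neighbour of v_i, so c = u_k with u_k below u_i, and d is a non-neighbour of u_i,
-- so d = v_m with u_i below u_m. By transitivity u_k lies below u_m, hence u_k v_m is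
-- not an edge of H: a contradiction.

open import Defs
open import Data.Nat using (ℕ)
open import Data.Fin using (Fin)
open import Data.Sum using (inj₁; inj₂)
open import Data.Product using (_,_)
open import Relation.Nullary using (¬_)
open import Relation.Binary.Definitions using (Transitive)
open import Relation.Binary.PropositionalEquality using (_≡_; _≢_; refl; sym; cong)
open import Relation.Binary.Structures using (IsStrictPartialOrder)

module _ {n : ℕ} {_<P_ : Fin n → Fin n → Set} where

  HAdj-sym : ∀ x y → HAdj _<P_ x y → HAdj _<P_ y x
  HAdj-sym (inj₁ _) (inj₁ _) ()
  HAdj-sym (inj₁ _) (inj₂ _) xy = xy
  HAdj-sym (inj₂ _) (inj₁ _) xy = xy
  HAdj-sym (inj₂ _) (inj₂ _) xy = λ y≡x → xy (sym y≡x)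

  -- Non-adjacency of u_k and v_m only gives ¬ ¬ (k <P m), so transitivity is applied
  -- under the double negation.
  nonneighbours-nonadjacent : Transitive _<P_ → ∀ i z w → inj₂ i ≢ z →
    ¬ HAdj _<P_ (inj₂ i) z → ¬ HAdj _<P_ (inj₁ i) w → ¬ HAdj _<P_ z w
  nonneighbours-nonadjacent trans i (inj₂ k) w vᵢ≢z vᵢ≁z _ _ =
    vᵢ≁z (λ i≡k → vᵢ≢z (cong inj₂ i≡k))
  nonneighbours-nonadjacent trans i (inj₁ k) (inj₁ m) _ _ _ ()
  nonneighbours-nonadjacent trans i (inj₁ k) (inj₂ m) _ vᵢ≁uₖ uᵢ≁vₘ k≮m =
    vᵢ≁uₖ (λ k<i → uᵢ≁vₘ (λ i<m → k≮m (trans k<i i<m)))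

  diagonal-edge-conflict-free : Transitive _<P_ → ∀ i z w → HAdj _<P_ z w →
    ¬ InConflict _<P_ (inj₁ i) (inj₂ i) z w
  diagonal-edge-conflict-free trans i z w zw
    (inj₁ ((_ , _ , _ , vᵢ≢z , _ , _) , uᵢ≁w , vᵢ≁z)) =
      nonneighbours-nonadjacent trans i z w vᵢ≢z vᵢ≁z uᵢ≁w zw
  diagonal-edge-conflict-free trans i z w zw
    (inj₂ (inj₁ ((_ , _ , vᵢ≢w , _ , _ , _) , vᵢ≁w , uᵢ≁z))) =
      nonneighbours-nonadjacent trans i w z vᵢ≢w vᵢ≁w uᵢ≁z (HAdj-sym z w zw)
  diagonal-edge-conflict-free trans i z w zw
    (inj₂ (inj₂ (inj₁ ((_ , _ , _ , vᵢ≢w , _ , _) , uᵢ≁z , vᵢ≁w)))) =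
      nonneighbours-nonadjacent trans i w z vᵢ≢w vᵢ≁w uᵢ≁z (HAdj-sym z w zw)
  diagonal-edge-conflict-free trans i z w zw
    (inj₂ (inj₂ (inj₂ ((_ , _ , vᵢ≢z , _ , _ , _) , vᵢ≁z , uᵢ≁w)))) =
      nonneighbours-nonadjacent trans i z w vᵢ≢z vᵢ≁z uᵢ≁w zw

lemma13 : (n : ℕ) (G : Fin n → Fin n → Set) (_<P_ : Fin n → Fin n → Set) →
    IsGraph G → IsStrictPartialOrder _≡_ _<P_ → ComparabilityIsComplement _<P_ G →
    ∀ (i : Fin n) → IsolatedInConflictGraph _<P_ (inj₁ i) (inj₂ i)
lemma13 n G _<P_ _ P-order _ i =
  irrefl refl , λ z w → diagonal-edge-conflict-free trans i z w
  where open IsStrictPartialOrder P-order
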